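{- Let $\lambda$ be any partition and let $n$ be the size of its Durfee square, i.e. the largest $n$ with $\lambda_n\ge n$. Then for all $1\le j\le i\le n$, \[ \sum_{k=j}^{n}(-1)^{j-k}\,D_{k,i}\binom{\lambda_k-j}{k-j}=\delta_{ij}, \] where $\delta_{ij}$ is the Kronecker delta.
   Context: For a partition $\lambda=(\lambda_1\ge\lambda_2\ge\cdots)$ with conjugate $\lambda'$, its Young diagram $D$ is the set of boxes $(i,j)$ (row $i$ from the top, column $j$ from the left) with $1\le j\le\lambda_i$. For a box $(i,j)\in D$, $D_{i,j}$ denotes the number of lattice paths inside $D$ from the lowest box $(\lambda'_j,j)$ of column $j$ to the rightmost box $(i,\lambda_i)$ of row $i$, where each step goes from a box $(a,b)$ to its northern neighbour $(a-1,b)$ or its eastern neighbour $(a,b+1)$, and every box of the path lies in $D$. -}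

module Defs where

open import Data.Nat using (ℕ; zero; suc; _+_; _*_; _∸_; _≤_; _≥_; _<_; _≡ᵇ_; _≤ᵇ_)
open import Data.Bool using (Bool; true; false; _∧_; if_then_else_)
open import Data.List using (List; []; _∷_; length; map; upTo; filter)
open import Data.List.Relation.Unary.All using (All)
open import Data.List.Relation.Unary.Linked using (Linked)
open import Data.Product using (_×_)
open import Data.Integer as ℤ using (ℤ)
open import Data.Nat.Combinatorics using (_C_)
open import Relation.Nullary.Decidable using (⌊_⌋)
import Data.Nat as ℕ

IsPartition : List ℕ → Set
IsPartition l = Linked _≥_ l × All (λ x → 0 < x) l

-- λ_i, 1-indexed; λ_i = 0 for i beyond the length, and (by convention) λ_0 = 0.
part : List ℕ → ℕ → ℕ
part l zero = 0
part [] (suc i) = 0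
part (x ∷ l) (suc zero) = x
part (x ∷ l) (suc (suc i)) = part l (suc i)

conj : List ℕ → ℕ → ℕ
conj l j = length (filter (λ x → j ℕ.≤? x) l)

inD : List ℕ → ℕ → ℕ → Bool
inD l a b = (1 ≤ᵇ a) ∧ (1 ≤ᵇ b) ∧ (b ≤ᵇ part l a)

-- pathsF l c d f a b : number of lattice paths inside D with exactly f steps,
-- each step north (a,b) ↦ (a-1,b) or east (a,b) ↦ (a,b+1), starting at box
-- (a,b) and ending at box (c,d), every box of the path lying in D.
pathsF : List ℕ → ℕ → ℕ → ℕ → ℕ → ℕ → ℕ
pathsF l c d zero a b =
  if inD l a b ∧ (a ≡ᵇ c) ∧ (b ≡ᵇ d) then 1 else 0
pathsF l c d (suc f) a b =
  if inD l a b then pathsF l c d f (a ∸ 1) b + pathsF l c d f a (suc b) else 0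

-- Number of lattice paths (north/east steps, inside D) from box (a,b) to box (c,d).
-- Every such path has exactly (a ∸ c) + (d ∸ b) steps (and there are none if
-- a < c or d < b, which this count also gives).
paths : List ℕ → ℕ → ℕ → ℕ → ℕ → ℕ
paths l a b c d = pathsF l c d ((a ∸ c) + (d ∸ b)) a b

-- D_{i,j}: number of lattice paths in D from the lowest box (λ'_j , j) of
-- column j to the rightmost box (i , λ_i) of row i.
Dpaths : List ℕ → ℕ → ℕ → ℕ
Dpaths l i j = paths l (conj l j) j i (part l i)

IsDurfee : List ℕ → ℕ → Set
IsDurfee l n = (n ≤ part l n) × (∀ m → m ≤ part l m → m ≤ n)

sumFromTo : ℕ → ℕ → (ℕ → ℤ) → ℤ
sumFromTo j n f = Data.List.foldr ℤ._+_ (ℤ.+ 0) (map (λ t → f (j + t)) (upTo (suc n ∸ j)))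

δ : ℕ → ℕ → ℤ
δ i j = if i ≡ᵇ j then ℤ.+ 1 else ℤ.+ 0

module Submission where

-- Write H(a, b) for the weighted count Σ_{k=j}^{n} (−1)^{k−j} C(λ_k − j, k − j) · #{paths from box
-- (a, b) to the row end (k, λ_k)}; the theorem says H(λ'_i, i) = δ_{ij}. Splitting off the first step of
-- a path gives H(a, b) = H(a − 1, b) + H(a, b + 1) inside the diagram, plus the weight of row a when
-- (a, b) = (a, λ_a) with j ≤ a ≤ n. In the rows j ≤ a ≤ n, where λ_a ≥ n ≥ a, this Pascal recurrence
-- with these boundary values is solved by the signed binomial H(a, b) = C(a − b, a − j) of the integer
-- a − b. Rows below row n have length at most n and no boundary term, so downward induction from
-- H(n, q) = C(n − q, n − j) = δ_{qj} gives H(p, q) = δ_{qj} for all p ≥ n and j ≤ q ≤ n; finally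
-- λ'_i ≥ n because λ_n ≥ n ≥ i.

open import Defs

module YoungDiagram where
  open import Data.Nat
    using (zero; suc; _+_; _∸_; _≤_; _<_; _≥_; z≤n; s≤s; _≤?_; _≡ᵇ_; _≤ᵇ_; _≤′_; ≤′-refl; ≤′-step)
  open import Data.Nat.Properties
    using ( _≟_; _<?_; ≤-refl; ≤-trans; ≤-<-trans; ≤-pred; <⇒≱; <⇒≢; ≮⇒≥; ≰⇒>; ≤⇒≤′; ≤′⇒≤
          ; m<n⇒m<1+n; suc-injective; 0≢1+n; +-suc; +-identityʳ; +-cancelʳ-≡; m+n≡0⇒m≡0; m+n≡0⇒n≡0
          ; m∸n≤m; m∸n+n≡m; n∸n≡0; m∸n≡0⇒m≤n )
  open import Data.Bool using (true; false)
  open import Data.Bool.Properties using (∧-zeroʳ)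
  open import Data.List using ([]; _∷_)
  open import Data.List.Properties using (filter-accept; filter-reject)
  open import Data.List.Relation.Unary.Linked using (Linked; []; [-]; _∷_; tail)
  open import Data.Product using (_,_)
  open import Data.Sum using (_⊎_; inj₁; inj₂)
  open import Relation.Binary.PropositionalEquality
  open import Relation.Nullary using (yes; no; contradiction)
  open import Relation.Nullary.Decidable using (dec-true; dec-false)
  open import Data.Nat.Tactic.RingSolver using (solve-∀)

  -- does (m ≟ n) reduces to m ≡ᵇ n and does (m ≤? n) to m ≤ᵇ n, so dec-true/dec-false decide these tests.
  ≡ᵇ-true : ∀ {m n} → m ≡ n → (m ≡ᵇ n) ≡ true
  ≡ᵇ-true {m} {n} = dec-true (m ≟ n)

  ≡ᵇ-false : ∀ {m n} → m ≢ n → (m ≡ᵇ n) ≡ false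
  ≡ᵇ-false {m} {n} = dec-false (m ≟ n)

  ≤ᵇ-true : ∀ {m n} → m ≤ n → (m ≤ᵇ n) ≡ true
  ≤ᵇ-true {m} {n} = dec-true (m ≤? n)

  ≤ᵇ-false : ∀ {m n} → n < m → (m ≤ᵇ n) ≡ false
  ≤ᵇ-false {m} {n} n<m = dec-false (m ≤? n) (<⇒≱ n<m)

  inD-true : ∀ l {a b} → 1 ≤ a → 1 ≤ b → b ≤ part l a → inD l a b ≡ true
  inD-true l 1≤a 1≤b b≤λa rewrite ≤ᵇ-true 1≤a | ≤ᵇ-true 1≤b | ≤ᵇ-true b≤λa = refl

  inD-false : ∀ l a b → part l a < b → inD l a b ≡ false
  inD-false l a b λa<b rewrite ≤ᵇ-false λa<b | ∧-zeroʳ (1 ≤ᵇ b) = ∧-zeroʳ (1 ≤ᵇ a)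

  part-suc-≤ : ∀ {l} → Linked _≥_ l → ∀ {b} → 1 ≤ b → part l (suc b) ≤ part l b
  part-suc-≤ []        {suc b}        _ = z≤n
  part-suc-≤ [-]       {suc b}        _ = z≤n
  part-suc-≤ (x≥y ∷ L) {suc zero}     _ = x≥y
  part-suc-≤ (_ ∷ L)   {suc (suc b)}  _ = part-suc-≤ L (s≤s z≤n)

  part-antitone : ∀ {l} → Linked _≥_ l → ∀ {a b} → 1 ≤ a → a ≤ b → part l b ≤ part l a
  part-antitone {l} L {a} 1≤a a≤b = go (≤⇒≤′ a≤b)
    where
    go : ∀ {b} → a ≤′ b → part l b ≤ part l a
    go ≤′-refl          = ≤-refl
    go (≤′-step a≤′b) = ≤-trans (part-suc-≤ L (≤-trans 1≤a (≤′⇒≤ a≤′b))) (go a≤′b)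

  part-≤-head : ∀ {x xs} → Linked _≥_ (x ∷ xs) → ∀ c → part xs c ≤ x
  part-≤-head L zero    = z≤n
  part-≤-head L (suc c) = part-antitone L {1} {suc (suc c)} (s≤s z≤n) (s≤s z≤n)

  ≤-part⇒≤-conj : ∀ {l} → Linked _≥_ l → ∀ {i m} → 1 ≤ i → i ≤ part l m → m ≤ conj l i
  ≤-part⇒≤-conj L          {m = zero}        _   _   = z≤n
  ≤-part⇒≤-conj {[]}     L {m = suc m}       1≤i i≤0 = contradiction i≤0 (<⇒≱ 1≤i)
  ≤-part⇒≤-conj {x ∷ xs} L {i} {suc zero}    1≤i i≤x
    rewrite filter-accept (i ≤?_) {x} {xs} i≤x = s≤s z≤n
  ≤-part⇒≤-conj {x ∷ xs} L {i} {suc (suc m)} 1≤i i≤λ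
    rewrite filter-accept (i ≤?_) {x} {xs} (≤-trans i≤λ (part-≤-head L (suc m))) = s≤s (≤-part⇒≤-conj (tail L) 1≤i i≤λ)

  ≤-part-conj : ∀ {l} → Linked _≥_ l → ∀ {i} → 1 ≤ conj l i → i ≤ part l (conj l i)
  ≤-part-conj {x ∷ xs} L {i} 1≤c with i ≤? x
  ... | yes i≤x rewrite filter-accept (i ≤?_) {x} {xs} i≤x = cons-case (conj xs i) (≤-part-conj (tail L))
    where
    cons-case : ∀ c → (1 ≤ c → i ≤ part xs c) → i ≤ part (x ∷ xs) (suc c)
    cons-case zero    _  = i≤x
    cons-case (suc c) ih = ih (s≤s z≤n)
  ... | no i≰x rewrite filter-reject (i ≤?_) {x} {xs} i≰x =
    contradiction (≤-trans (≤-part-conj (tail L) 1≤c) (part-≤-head L (conj xs i))) i≰x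

  durfee-diagonal : ∀ {l n} → Linked _≥_ l → IsDurfee l n → ∀ {a} → 1 ≤ a → a ≤ n → a ≤ part l a
  durfee-diagonal L (n≤λn , _) 1≤a a≤n = ≤-trans a≤n (≤-trans n≤λn (part-antitone L 1≤a a≤n))

  durfee-below : ∀ {l n} → Linked _≥_ l → IsDurfee l n → ∀ {p} → n < p → part l p ≤ n
  durfee-below {l} {n} L (_ , maximal) n<p with suc n ≤? part l (suc n)
  ... | yes n<λ = contradiction (maximal (suc n) n<λ) (<⇒≱ ≤-refl)
  ... | no n≮λ = ≤-pred (≤-trans (s≤s (part-antitone L (s≤s z≤n) n<p)) (≰⇒> n≮λ))

  pathsF-zero-≢ : ∀ l a b c d → a ≢ c ⊎ b ≢ d → pathsF l c d 0 a b ≡ 0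
  pathsF-zero-≢ l a b c d (inj₁ a≢c) rewrite ≡ᵇ-false a≢c | ∧-zeroʳ (inD l a b) = refl
  pathsF-zero-≢ l a b c d (inj₂ b≢d)
    rewrite ≡ᵇ-false b≢d | ∧-zeroʳ (a ≡ᵇ c) | ∧-zeroʳ (inD l a b) = refl

  pathsF-zero-refl : ∀ l a b → inD l a b ≡ true → pathsF l a b 0 a b ≡ 1
  pathsF-zero-refl l a b ab∈D rewrite ab∈D | ≡ᵇ-true {a} refl | ≡ᵇ-true {b} refl = refl

  pathsF-north-vanish : ∀ l {a c} b d f → a < c → pathsF l c d f a b ≡ 0
  pathsF-north-vanish l {a} {c} b d zero    a<c = pathsF-zero-≢ l a b c d (inj₁ (<⇒≢ a<c))
  pathsF-north-vanish l {a} b d (suc f) a<c with inD l a b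
  ... | false = refl
  ... | true  = cong₂ _+_ (pathsF-north-vanish l b d f (≤-<-trans (m∸n≤m a 1) a<c))
                          (pathsF-north-vanish l (suc b) d f a<c)

  pathsF-east-vanish : ∀ l a c {b d} f → d < b → pathsF l c d f a b ≡ 0
  pathsF-east-vanish l a c {b} {d} zero    d<b = pathsF-zero-≢ l a b c d (inj₂ (≢-sym (<⇒≢ d<b)))
  pathsF-east-vanish l a c {b} (suc f) d<b with inD l a b
  ... | false = refl
  ... | true  = cong₂ _+_ (pathsF-east-vanish l (a ∸ 1) c f d<b) (pathsF-east-vanish l a c f (m<n⇒m<1+n d<b))

  paths-outside : ∀ l {a b} c d → inD l a b ≡ false → paths l a b c d ≡ 0
  paths-outside l {a} {b} c d ab∉D with (a ∸ c) + (d ∸ b)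
  ... | zero  rewrite ab∉D = refl
  ... | suc f rewrite ab∉D = refl

  paths-north-vanish : ∀ l {a c} b d → a < c → paths l a b c d ≡ 0
  paths-north-vanish l {a} {c} b d = pathsF-north-vanish l b d ((a ∸ c) + (d ∸ b))

  paths-east-vanish : ∀ l a c {b d} → d < b → paths l a b c d ≡ 0
  paths-east-vanish l a c {b} {d} = pathsF-east-vanish l a c ((a ∸ c) + (d ∸ b))

  [a∸c]+[d∸b]+b+c≡a+d : ∀ {a b c d} → c ≤ a → b ≤ d → (a ∸ c) + (d ∸ b) + b + c ≡ a + d
  [a∸c]+[d∸b]+b+c≡a+d {a} {b} {c} {d} c≤a b≤d = begin
    (a ∸ c) + (d ∸ b) + b + c   ≡⟨ regroup (a ∸ c) (d ∸ b) b c ⟩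
    (a ∸ c + c) + (d ∸ b + b)   ≡⟨ cong₂ _+_ (m∸n+n≡m c≤a) (m∸n+n≡m b≤d) ⟩
    a + d                       ∎
    where
    open ≡-Reasoning
    regroup : ∀ x y b c → x + y + b + c ≡ (x + c) + (y + b)
    regroup = solve-∀

  pathsF≡paths : ∀ l a b c d f → f + b + c ≡ a + d → pathsF l c d f a b ≡ paths l a b c d
  pathsF≡paths l a b c d f eq with a <? c | d <? b
  ... | yes a<c | _       = trans (pathsF-north-vanish l b d f a<c) (sym (paths-north-vanish l b d a<c))
  ... | no _    | yes d<b = trans (pathsF-east-vanish l a c f d<b) (sym (paths-east-vanish l a c d<b))
  ... | no a≮c  | no d≮b  = cong (λ g → pathsF l c d g a b)
    (+-cancelʳ-≡ b _ _ (+-cancelʳ-≡ c _ _ (trans eq (sym ([a∸c]+[d∸b]+b+c≡a+d (≮⇒≥ a≮c) (≮⇒≥ d≮b))))))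

  pathsF-zero-far : ∀ l a b c d {f} → (a ∸ c) + (d ∸ b) ≡ suc f → pathsF l c d 0 a b ≡ 0
  pathsF-zero-far l a b c d steps with a ≟ c | b ≟ d
  ... | no a≢c   | _        = pathsF-zero-≢ l a b c d (inj₁ a≢c)
  ... | yes _    | no b≢d   = pathsF-zero-≢ l a b c d (inj₂ b≢d)
  ... | yes refl | yes refl = contradiction (trans (sym (cong₂ _+_ (n∸n≡0 a) (n∸n≡0 b))) steps) 0≢1+n

  paths-step-inside : ∀ l a b c d → inD l a b ≡ true → c ≤ a → b ≤ d →
    paths l a b c d ≡ paths l (a ∸ 1) b c d + (paths l a (suc b) c d + pathsF l c d 0 a b)
  paths-step-inside l zero    b c d ()  -- inD l 0 b computes to false
  paths-step-inside l (suc a) b c d ab∈D c≤a b≤d with (suc a ∸ c) + (d ∸ b) in steps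
  ... | zero = sym (cong₂ _+_ (paths-north-vanish l {a} {c} b d (m∸n≡0⇒m≤n (m+n≡0⇒m≡0 _ steps)))
                              (cong (_+ pathsF l c d 0 (suc a) b)
                                    (paths-east-vanish l (suc a) c {suc b} {d} (s≤s (m∸n≡0⇒m≤n (m+n≡0⇒n≡0 (suc a ∸ c) steps))))))
  ... | suc f rewrite pathsF-zero-far l (suc a) b c d steps | ab∈D =
    cong₂ _+_ (pathsF≡paths l a b c d f (suc-injective walk))
              (trans (pathsF≡paths l (suc a) (suc b) c d f (trans (cong (_+ c) (+-suc f b)) walk)) (sym (+-identityʳ _)))
    where
    walk : suc f + b + c ≡ suc a + d
    walk = trans (cong (λ s → s + b + c) (sym steps)) ([a∸c]+[d∸b]+b+c≡a+d c≤a b≤d)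

  paths-step : ∀ l a b c d → inD l a b ≡ true →
    paths l a b c d ≡ paths l (a ∸ 1) b c d + (paths l a (suc b) c d + pathsF l c d 0 a b)
  paths-step l a b c d ab∈D with a <? c | d <? b
  ... | yes a<c | _ = trans (paths-north-vanish l b d a<c)
    (sym (cong₂ _+_ (paths-north-vanish l b d (≤-<-trans (m∸n≤m a 1) a<c))
                    (cong₂ _+_ (paths-north-vanish l (suc b) d a<c) (pathsF-north-vanish l b d 0 a<c))))
  ... | no _ | yes d<b = trans (paths-east-vanish l a c d<b)
    (sym (cong₂ _+_ (paths-east-vanish l (a ∸ 1) c d<b)
                    (cong₂ _+_ (paths-east-vanish l a c (m<n⇒m<1+n d<b)) (pathsF-east-vanish l a c 0 d<b))))
  ... | no a≮c | no d≮b = paths-step-inside l a b c d ab∈D (≮⇒≥ a≮c) (≮⇒≥ d≮b)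

open YoungDiagram

open import Data.Nat as ℕ using (ℕ; zero; suc; _∸_; _≤_; _<_; _≥_; z≤n; s≤s; z<s; s<s)
import Data.Nat.Properties as ℕ
open import Data.Nat.Combinatorics using (_C_; nCn≡1; nCk+nC[k+1]≡[n+1]C[k+1]; k>n⇒nCk≡0)
open import Data.Integer as ℤ using (ℤ; +_; _+_; _*_; _^_; -1ℤ)
import Data.Integer.Properties as ℤ
open import Data.Integer.Tactic.RingSolver using (solve-∀)
open import Algebra.Properties.CommutativeSemigroup ℤ.+-commutativeSemigroup using (interchange)
open import Data.Bool using (true; false; if_then_else_)
open import Data.List using (List; foldr; applyUpTo)
open import Data.List.Properties using (map-applyUpTo)
open import Data.List.Relation.Unary.Linked using (Linked)
open import Data.Product using (_,_; proj₁)
open import Data.Sum using (_⊎_; inj₁; inj₂)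
open import Function using (id; _∘_)
open import Relation.Binary.PropositionalEquality
open import Relation.Nullary using (yes; no)

sumUpTo : ℕ → (ℕ → ℤ) → ℤ
sumUpTo m F = foldr _+_ (+ 0) (applyUpTo F m)

sumFromTo≡sumUpTo : ∀ j n f → sumFromTo j n f ≡ sumUpTo (suc n ∸ j) (λ t → f (j ℕ.+ t))
sumFromTo≡sumUpTo j n f = cong (foldr _+_ (+ 0)) (map-applyUpTo id (λ t → f (j ℕ.+ t)) (suc n ∸ j))

sumUpTo-cong : ∀ m {F G} → (∀ {t} → t < m → F t ≡ G t) → sumUpTo m F ≡ sumUpTo m G
sumUpTo-cong zero    _   = refl
sumUpTo-cong (suc m) F≗G = cong₂ _+_ (F≗G z<s) (sumUpTo-cong m (F≗G ∘ s<s))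

sumUpTo-+ : ∀ m F G → sumUpTo m (λ t → F t + G t) ≡ sumUpTo m F + sumUpTo m G
sumUpTo-+ zero    F G = refl
sumUpTo-+ (suc m) F G = trans (cong (_+_ (F 0 + G 0)) (sumUpTo-+ m (F ∘ suc) (G ∘ suc)))
                              (interchange (F 0) (G 0) (sumUpTo m (F ∘ suc)) (sumUpTo m (G ∘ suc)))

sumUpTo-zero : ∀ m {F} → (∀ {t} → t < m → F t ≡ + 0) → sumUpTo m F ≡ + 0
sumUpTo-zero zero    _   = refl
sumUpTo-zero (suc m) F≡0 = cong₂ _+_ (F≡0 z<s) (sumUpTo-zero m (F≡0 ∘ s<s))

sumUpTo-single : ∀ m {F t₀} → t₀ < m → (∀ {t} → t < m → t ≢ t₀ → F t ≡ + 0) → sumUpTo m F ≡ F t₀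
sumUpTo-single (suc m) {F} {zero} _ others =
  trans (cong (_+_ (F 0)) (sumUpTo-zero m (λ t<m → others (s<s t<m) λ ()))) (ℤ.+-identityʳ (F 0))
sumUpTo-single (suc m) {F} {suc t₀} (s<s t₀<m) others =
  trans (cong (_+ sumUpTo m (F ∘ suc)) (others z<s λ ()))
        (trans (ℤ.+-identityˡ _) (sumUpTo-single m t₀<m (λ t<m t≢t₀ → others (s<s t<m) (t≢t₀ ∘ ℕ.suc-injective))))

m<[1+n]∸o⇒o+m≤n : ∀ {j n t} → t < suc n ∸ j → j ℕ.+ t ≤ n
m<[1+n]∸o⇒o+m≤n {j} {n} {t} t<m = ℕ.≤-pred (subst (_≤ suc n) (cong suc (ℕ.+-comm t j))
  (ℕ.m≤o∸n⇒m+n≤o (suc t) (ℕ.<⇒≤ (ℕ.m∸n≢0⇒n<m (ℕ.>⇒≢ (ℕ.<-≤-trans z<s t<m)))) t<m))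

sumFromTo-cong : ∀ j n {f g} → (∀ {k} → j ≤ k → k ≤ n → f k ≡ g k) → sumFromTo j n f ≡ sumFromTo j n g
sumFromTo-cong j n {f} {g} f≗g = begin
  sumFromTo j n f                               ≡⟨ sumFromTo≡sumUpTo j n f ⟩
  sumUpTo (suc n ∸ j) (λ t → f (j ℕ.+ t))      ≡⟨ sumUpTo-cong _ (λ {t} t<m → f≗g (ℕ.m≤m+n j t) (m<[1+n]∸o⇒o+m≤n t<m)) ⟩
  sumUpTo (suc n ∸ j) (λ t → g (j ℕ.+ t))      ≡⟨ sumFromTo≡sumUpTo j n g ⟨
  sumFromTo j n g                               ∎
  where open ≡-Reasoning

sumFromTo-+ : ∀ j n f g → sumFromTo j n (λ k → f k + g k) ≡ sumFromTo j n f + sumFromTo j n g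
sumFromTo-+ j n f g = begin
  sumFromTo j n (λ k → f k + g k)                                ≡⟨ sumFromTo≡sumUpTo j n (λ k → f k + g k) ⟩
  sumUpTo m (λ t → f (j ℕ.+ t) + g (j ℕ.+ t))                    ≡⟨ sumUpTo-+ m _ _ ⟩
  sumUpTo m (λ t → f (j ℕ.+ t)) + sumUpTo m (λ t → g (j ℕ.+ t))  ≡⟨ cong₂ _+_ (sumFromTo≡sumUpTo j n f) (sumFromTo≡sumUpTo j n g) ⟨
  sumFromTo j n f + sumFromTo j n g                              ∎
  where
  open ≡-Reasoning
  m : ℕ
  m = suc n ∸ j

sumFromTo-zero : ∀ j n {f} → (∀ {k} → j ≤ k → k ≤ n → f k ≡ + 0) → sumFromTo j n f ≡ + 0
sumFromTo-zero j n {f} f≡0 = trans (sumFromTo≡sumUpTo j n f)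
  (sumUpTo-zero _ (λ {t} t<m → f≡0 (ℕ.m≤m+n j t) (m<[1+n]∸o⇒o+m≤n t<m)))

sumFromTo-single : ∀ j n {f k₀} → j ≤ k₀ → k₀ ≤ n → (∀ {k} → j ≤ k → k ≤ n → k ≢ k₀ → f k ≡ + 0) →
  sumFromTo j n f ≡ f k₀
sumFromTo-single j n {f} {k₀} j≤k₀ k₀≤n others = begin
  sumFromTo j n f                          ≡⟨ sumFromTo≡sumUpTo j n f ⟩
  sumUpTo (suc n ∸ j) (λ t → f (j ℕ.+ t))  ≡⟨ sumUpTo-single _ (ℕ.∸-monoˡ-< (s≤s k₀≤n) j≤k₀) others′ ⟩
  f (j ℕ.+ (k₀ ∸ j))                        ≡⟨ cong f (ℕ.m+[n∸m]≡n j≤k₀) ⟩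
  f k₀                                     ∎
  where
  open ≡-Reasoning
  others′ : ∀ {t} → t < suc n ∸ j → t ≢ k₀ ∸ j → f (j ℕ.+ t) ≡ + 0
  others′ {t} t<m t≢ = others (ℕ.m≤m+n j t) (m<[1+n]∸o⇒o+m≤n t<m)
    (λ j+t≡k₀ → t≢ (trans (sym (ℕ.m+n∸m≡n j t)) (cong (_∸ j) j+t≡k₀)))

-- The binomial coefficient C(a − b, r) of the integer a − b; for a < b it is the upper negation
-- C(−m, r) = (−1)^r C(m + r − 1, r).
diffChoose : ℕ → ℕ → ℕ → ℤ
diffChoose a       zero    r = + (a C r)
diffChoose zero    (suc b) r = (-1ℤ ^ r) * + ((b ℕ.+ r) C r)
diffChoose (suc a) (suc b) r = diffChoose a b r

diffChoose-zero : ∀ a b → diffChoose a b 0 ≡ + 1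
diffChoose-zero a       zero    = refl
diffChoose-zero zero    (suc b) = refl
diffChoose-zero (suc a) (suc b) = diffChoose-zero a b

pos-pascal : ∀ m r → + (suc m C suc r) ≡ + (m C r) ℤ.+ + (m C suc r)
pos-pascal m r = trans (cong +_ (sym (nCk+nC[k+1]≡[n+1]C[k+1] m r))) (ℤ.pos-+ (m C r) (m C suc r))

diffChoose-pascal : ∀ a b r → diffChoose a b (suc r) ≡ diffChoose a (suc b) r ℤ.+ diffChoose a (suc b) (suc r)
diffChoose-pascal (suc a) zero    r = pos-pascal a r
diffChoose-pascal zero    zero    r rewrite nCn≡1 r | nCn≡1 (suc r) = cancel (-1ℤ ^ r)
  where
  cancel : ∀ s → + 0 ≡ s * + 1 ℤ.+ (-1ℤ * s) * + 1
  cancel = solve-∀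
diffChoose-pascal zero    (suc b) r =
  trans (expand (-1ℤ ^ r) (+ (N C r)) (+ (N C suc r)))
        (cong₂ (λ m x → (-1ℤ ^ r) * + (m C r) ℤ.+ (-1ℤ ^ suc r) * x) (ℕ.+-suc b r) (sym (pos-pascal N r)))
  where
  N : ℕ
  N = b ℕ.+ suc r
  expand : ∀ s x y → (-1ℤ * s) * y ≡ s * x ℤ.+ (-1ℤ * s) * (x ℤ.+ y)
  expand = solve-∀
diffChoose-pascal (suc a) (suc b) r = diffChoose-pascal a b r

diffChoose-nonneg : ∀ {a b} r → b ≤ a → diffChoose a b r ≡ + ((a ∸ b) C r)
diffChoose-nonneg r z≤n       = refl
diffChoose-nonneg r (s≤s b≤a) = diffChoose-nonneg r b≤a

diffChoose-neg : ∀ {a b} r → a ≤ b → diffChoose a (suc b) r ≡ (-1ℤ ^ r) * + ((b ∸ a ℕ.+ r) C r)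
diffChoose-neg r z≤n       = refl
diffChoose-neg r (s≤s a≤b) = diffChoose-neg r a≤b

module WeightedPathCount (l : List ℕ) (n j : ℕ) where

  summand : ℕ → ℕ → ℤ
  summand k m = (-1ℤ ^ (k ∸ j)) * + m * + ((part l k ∸ j) C (k ∸ j))

  weighted : (ℕ → ℕ) → ℤ
  weighted p = sumFromTo j n (λ k → summand k (p k))

  weightedPaths : ℕ → ℕ → ℤ
  weightedPaths a b = weighted (λ k → paths l a b k (part l k))

  weightedRowEnd : ℕ → ℕ → ℤ
  weightedRowEnd a b = weighted (λ k → pathsF l k (part l k) 0 a b)

  summand-+ : ∀ k x y → summand k (x ℕ.+ y) ≡ summand k x + summand k y
  summand-+ k x y rewrite ℤ.pos-+ x y = distrib (-1ℤ ^ (k ∸ j)) (+ x) (+ y) (+ ((part l k ∸ j) C (k ∸ j)))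
    where
    distrib : ∀ s x y e → s * (x + y) * e ≡ s * x * e + s * y * e
    distrib = solve-∀

  summand-zero : ∀ k → summand k 0 ≡ + 0
  summand-zero k rewrite ℤ.*-zeroʳ (-1ℤ ^ (k ∸ j)) = refl

  weighted-cong : ∀ {p q} → (∀ {k} → j ≤ k → k ≤ n → p k ≡ q k) → weighted p ≡ weighted q
  weighted-cong p≗q = sumFromTo-cong j n (λ {k} j≤k k≤n → cong (summand k) (p≗q j≤k k≤n))

  weighted-+ : ∀ p q → weighted (λ k → p k ℕ.+ q k) ≡ weighted p + weighted q
  weighted-+ p q = trans (sumFromTo-cong j n (λ {k} _ _ → summand-+ k (p k) (q k)))
                         (sumFromTo-+ j n (λ k → summand k (p k)) (λ k → summand k (q k)))

  weighted-zero : ∀ {p} → (∀ {k} → j ≤ k → k ≤ n → p k ≡ 0) → weighted p ≡ + 0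
  weighted-zero p≡0 = sumFromTo-zero j n (λ {k} j≤k k≤n → trans (cong (summand k) (p≡0 j≤k k≤n)) (summand-zero k))

  weighted-single : ∀ {p a} → j ≤ a → a ≤ n → (∀ {k} → j ≤ k → k ≤ n → k ≢ a → p k ≡ 0) →
    weighted p ≡ summand a (p a)
  weighted-single j≤a a≤n others = sumFromTo-single j n j≤a a≤n
    (λ {k} j≤k k≤n k≢a → trans (cong (summand k) (others j≤k k≤n k≢a)) (summand-zero k))

  weightedPaths-step : ∀ a b → inD l a b ≡ true →
    weightedPaths a b ≡ weightedPaths (a ∸ 1) b + (weightedPaths a (suc b) + weightedRowEnd a b)
  weightedPaths-step a b ab∈D = begin
    weightedPaths a b
      ≡⟨ weighted-cong (λ {k} _ _ → paths-step l a b k (part l k) ab∈D) ⟩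
    weighted (λ k → north k ℕ.+ (east k ℕ.+ stop k))
      ≡⟨ weighted-+ north (λ k → east k ℕ.+ stop k) ⟩
    weightedPaths (a ∸ 1) b + weighted (λ k → east k ℕ.+ stop k)
      ≡⟨ cong (_+_ (weightedPaths (a ∸ 1) b)) (weighted-+ east stop) ⟩
    weightedPaths (a ∸ 1) b + (weightedPaths a (suc b) + weightedRowEnd a b) ∎
    where
    open ≡-Reasoning
    north east stop : ℕ → ℕ
    north k = paths l (a ∸ 1) b k (part l k)
    east  k = paths l a (suc b) k (part l k)
    stop  k = pathsF l k (part l k) 0 a b

  weightedPaths-outside : ∀ a b → inD l a b ≡ false → weightedPaths a b ≡ + 0
  weightedPaths-outside a b ab∉D = weighted-zero (λ {k} _ _ → paths-outside l {a} {b} k (part l k) ab∉D)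

  weightedPaths-north : ∀ {a} b → a < j → weightedPaths a b ≡ + 0
  weightedPaths-north b a<j = weighted-zero (λ {k} j≤k _ → paths-north-vanish l b (part l k) (ℕ.<-≤-trans a<j j≤k))

  weightedRowEnd-vanish : ∀ a b → n < a ⊎ b ≢ part l a → weightedRowEnd a b ≡ + 0
  weightedRowEnd-vanish a b off = weighted-zero (λ {k} _ k≤n → pathsF-zero-≢ l a b k (part l k) (apart off k≤n))
    where
    apart : ∀ {k} → n < a ⊎ b ≢ part l a → k ≤ n → a ≢ k ⊎ b ≢ part l k
    apart (inj₁ n<a) k≤n = inj₁ (λ { refl → ℕ.<⇒≱ n<a k≤n })
    apart {k} (inj₂ b≢λ) _ with a ℕ.≟ k
    ... | yes refl = inj₂ b≢λ
    ... | no a≢k   = inj₁ a≢k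

  weightedRowEnd-hit : ∀ {a} → inD l a (part l a) ≡ true → j ≤ a → a ≤ n → weightedRowEnd a (part l a) ≡ summand a 1
  weightedRowEnd-hit {a} a∈D j≤a a≤n = trans
    (weighted-single j≤a a≤n (λ {k} _ _ k≢a → pathsF-zero-≢ l a (part l a) k (part l k) (inj₁ (k≢a ∘ sym))))
    (cong (summand a) (pathsF-zero-refl l a (part l a) a∈D))

  below-durfee-step : ∀ {p q} → n < p → inD l p q ≡ true →
    weightedPaths (p ∸ 1) q ≡ δ q j → weightedPaths p (suc q) ≡ + 0 → weightedPaths p q ≡ δ q j
  below-durfee-step {p} {q} n<p pq∈D north east = begin
    weightedPaths p q                                                     ≡⟨ weightedPaths-step p q pq∈D ⟩
    weightedPaths (p ∸ 1) q + (weightedPaths p (suc q) + weightedRowEnd p q) ≡⟨ cong₂ _+_ north (cong₂ _+_ east (weightedRowEnd-vanish p q (inj₁ n<p))) ⟩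
    δ q j + (+ 0 + + 0)                                                   ≡⟨ ℤ.+-identityʳ _ ⟩
    δ q j                                                                 ∎
    where open ≡-Reasoning

m∸[n+o]+n≡m∸o : ∀ m n o → n ℕ.+ o ≤ m → m ∸ (n ℕ.+ o) ℕ.+ n ≡ m ∸ o
m∸[n+o]+n≡m∸o m n o n+o≤m = begin
  m ∸ (n ℕ.+ o) ℕ.+ n  ≡⟨ cong (λ x → m ∸ x ℕ.+ n) (ℕ.+-comm n o) ⟩
  m ∸ (o ℕ.+ n) ℕ.+ n  ≡⟨ cong (ℕ._+ n) (ℕ.∸-+-assoc m o n) ⟨
  m ∸ o ∸ n ℕ.+ n      ≡⟨ ℕ.m∸n+n≡m (ℕ.m+n≤o⇒m≤o∸n n n+o≤m) ⟩
  m ∸ o                ∎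
  where open ≡-Reasoning

δ-≢ : ∀ {i j} → i ≢ j → δ i j ≡ + 0
δ-≢ i≢j = cong (λ b → if b then + 1 else + 0) (≡ᵇ-false i≢j)

[n∸q]C[n∸j]≡δqj : ∀ {n q j} → j ≤ q → q ≤ n → + ((n ∸ q) C (n ∸ j)) ≡ δ q j
[n∸q]C[n∸j]≡δqj {n} {q} {j} j≤q q≤n with q ℕ.≟ j
... | yes refl rewrite ≡ᵇ-true {q} refl = cong +_ (nCn≡1 (n ∸ q))
... | no q≢j = trans (cong +_ (k>n⇒nCk≡0 (ℕ.∸-monoʳ-< (ℕ.≤∧≢⇒< j≤q (q≢j ∘ sym)) q≤n))) (sym (δ-≢ q≢j))

module _ {l : List ℕ} (L : Linked _≥_ l) {n : ℕ} (durfee : IsDurfee l n) {j : ℕ} (1≤j : 1 ≤ j) where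

  open WeightedPathCount l n j

  durfee-row : ∀ d {a} → d ℕ.+ j ≡ a → a ≤ n → ∀ t {b} → 1 ≤ b → t ℕ.+ b ≡ part l a →
    weightedPaths a b ≡ diffChoose a b d
  durfee-row-east : ∀ d {a} → d ℕ.+ j ≡ a → a ≤ n → ∀ t {b} → 1 ≤ b → t ℕ.+ b ≡ part l a →
    weightedPaths a (suc b) + weightedRowEnd a b ≡ diffChoose a (suc b) d

  durfee-row zero refl a≤n t {b} 1≤b t+b≡λ = begin
    weightedPaths j b
      ≡⟨ weightedPaths-step j b (inD-true l 1≤j 1≤b (subst (b ≤_) t+b≡λ (ℕ.m≤n+m b t))) ⟩
    weightedPaths (j ∸ 1) b + (weightedPaths j (suc b) + weightedRowEnd j b)
      ≡⟨ cong₂ _+_ (weightedPaths-north b (ℕ.∸-monoʳ-< z<s 1≤j)) (durfee-row-east zero refl a≤n t 1≤b t+b≡λ) ⟩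
    + 0 + diffChoose j (suc b) 0
      ≡⟨ ℤ.+-identityˡ _ ⟩
    diffChoose j (suc b) 0
      ≡⟨ trans (diffChoose-zero j (suc b)) (sym (diffChoose-zero j b)) ⟩
    diffChoose j b 0 ∎
    where open ≡-Reasoning
  durfee-row (suc d) refl a≤n t {b} 1≤b t+b≡λ = begin
    weightedPaths (suc a) b
      ≡⟨ weightedPaths-step (suc a) b (inD-true l (s≤s z≤n) 1≤b b≤λ) ⟩
    weightedPaths a b + (weightedPaths (suc a) (suc b) + weightedRowEnd (suc a) b)
      ≡⟨ cong₂ _+_ (durfee-row d refl (ℕ.<⇒≤ a≤n) (part l a ∸ b) 1≤b (ℕ.m∸n+n≡m b≤λ′))
                   (durfee-row-east (suc d) refl a≤n t 1≤b t+b≡λ) ⟩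
    diffChoose a b d + diffChoose (suc a) (suc b) (suc d)
      ≡⟨ diffChoose-pascal (suc a) b d ⟨
    diffChoose (suc a) b (suc d) ∎
    where
    open ≡-Reasoning
    a : ℕ
    a = d ℕ.+ j
    b≤λ : b ≤ part l (suc a)
    b≤λ = subst (b ≤_) t+b≡λ (ℕ.m≤n+m b t)
    b≤λ′ : b ≤ part l a
    b≤λ′ = ℕ.≤-trans b≤λ (part-antitone L (ℕ.≤-trans 1≤j (ℕ.m≤n+m j d)) (ℕ.n≤1+n a))

  durfee-row-east d refl a≤n zero {b} 1≤b refl = begin
    weightedPaths a (suc λa) + weightedRowEnd a λa
      ≡⟨ cong₂ _+_ (weightedPaths-outside a (suc λa) (inD-false l a (suc λa) ℕ.≤-refl))
                   (weightedRowEnd-hit (inD-true l 1≤a 1≤b ℕ.≤-refl) j≤a a≤n) ⟩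
    + 0 + summand a 1
      ≡⟨ ℤ.+-identityˡ _ ⟩
    (-1ℤ ^ (a ∸ j)) * + 1 * + ((λa ∸ j) C (a ∸ j))
      ≡⟨ cong (λ r → (-1ℤ ^ r) * + 1 * + ((λa ∸ j) C r)) (ℕ.m+n∸n≡m d j) ⟩
    (-1ℤ ^ d) * + 1 * + ((λa ∸ j) C d)
      ≡⟨ cong (_* + ((λa ∸ j) C d)) (ℤ.*-identityʳ (-1ℤ ^ d)) ⟩
    (-1ℤ ^ d) * + ((λa ∸ j) C d)
      ≡⟨ cong (λ x → (-1ℤ ^ d) * + (x C d)) (m∸[n+o]+n≡m∸o λa d j a≤λa) ⟨
    (-1ℤ ^ d) * + ((λa ∸ a ℕ.+ d) C d)
      ≡⟨ diffChoose-neg d a≤λa ⟨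
    diffChoose a (suc λa) d ∎
    where
    open ≡-Reasoning
    a λa : ℕ
    a = d ℕ.+ j
    λa = part l a
    j≤a : j ≤ a
    j≤a = ℕ.m≤n+m j d
    1≤a : 1 ≤ a
    1≤a = ℕ.≤-trans 1≤j j≤a
    a≤λa : a ≤ λa
    a≤λa = durfee-diagonal L durfee 1≤a a≤n
  durfee-row-east d refl a≤n (suc t) {b} 1≤b t+b≡λ = begin
    weightedPaths a (suc b) + weightedRowEnd a b
      ≡⟨ cong₂ _+_ (durfee-row d refl a≤n t (s≤s z≤n) (trans (ℕ.+-suc t b) t+b≡λ))
                   (weightedRowEnd-vanish a b (inj₂ (ℕ.<⇒≢ (subst (b <_) t+b≡λ (s≤s (ℕ.m≤n+m b t)))))) ⟩
    diffChoose a (suc b) d + + 0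
      ≡⟨ ℤ.+-identityʳ _ ⟩
    diffChoose a (suc b) d ∎
    where
    open ≡-Reasoning
    a : ℕ
    a = d ℕ.+ j

  below-durfee : ∀ s {p} → s ℕ.+ n ≡ p → ∀ t {q} → j ≤ q → q ≤ n → t ℕ.+ q ≡ part l p →
    weightedPaths p q ≡ δ q j
  below-durfee-east : ∀ s {p} → s ℕ.+ n ≡ p → n < p → ∀ t {q} → j ≤ q → q ≤ n → t ℕ.+ q ≡ part l p →
    weightedPaths p (suc q) ≡ + 0

  below-durfee zero refl t {q} j≤q q≤n t+q≡λ = begin
    weightedPaths n q          ≡⟨ durfee-row (n ∸ j) (ℕ.m∸n+n≡m (ℕ.≤-trans j≤q q≤n)) ℕ.≤-refl t (ℕ.≤-trans 1≤j j≤q) t+q≡λ ⟩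
    diffChoose n q (n ∸ j)     ≡⟨ diffChoose-nonneg (n ∸ j) q≤n ⟩
    + ((n ∸ q) C (n ∸ j))      ≡⟨ [n∸q]C[n∸j]≡δqj j≤q q≤n ⟩
    δ q j                      ∎
    where open ≡-Reasoning
  below-durfee (suc s) refl t {q} j≤q q≤n t+q≡λ = below-durfee-step n<p (inD-true l (s≤s z≤n) 1≤q q≤λ)
    (below-durfee s refl (part l p ∸ q) j≤q q≤n (ℕ.m∸n+n≡m q≤λ′))
    (below-durfee-east (suc s) refl n<p t j≤q q≤n t+q≡λ)
    where
    p : ℕ
    p = s ℕ.+ n
    n<p : n < suc p
    n<p = s≤s (ℕ.m≤n+m n s)
    1≤q : 1 ≤ q
    1≤q = ℕ.≤-trans 1≤j j≤q
    q≤λ : q ≤ part l (suc p)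
    q≤λ = subst (q ≤_) t+q≡λ (ℕ.m≤n+m q t)
    q≤λ′ : q ≤ part l p
    q≤λ′ = ℕ.≤-trans q≤λ (part-antitone L (ℕ.≤-trans 1≤q (ℕ.≤-trans q≤n (ℕ.m≤n+m n s))) (ℕ.n≤1+n p))

  below-durfee-east s refl n<p zero    j≤q q≤n refl =
    weightedPaths-outside (s ℕ.+ n) _ (inD-false l (s ℕ.+ n) _ ℕ.≤-refl)
  below-durfee-east s refl n<p (suc t) {q} j≤q q≤n t+q≡λ = trans
    (below-durfee s refl t (ℕ.m≤n⇒m≤1+n j≤q) q<n (trans (ℕ.+-suc t q) t+q≡λ))
    (δ-≢ (ℕ.<⇒≢ (s≤s j≤q) ∘ sym))
    where
    q<n : q < n
    q<n = ℕ.≤-trans (subst (q <_) t+q≡λ (s≤s (ℕ.m≤n+m q t))) (durfee-below L durfee n<p)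

mainTheorem2 : (l : List ℕ) → IsPartition l → (n : ℕ) → IsDurfee l n →
    (i j : ℕ) → 1 ≤ j → j ≤ i → i ≤ n →
    sumFromTo j n (λ k → (-1ℤ ^ (k ∸ j)) * (+ Dpaths l k i) * (+ ((part l k ∸ j) C (k ∸ j))))
    ≡ δ i j
mainTheorem2 l (L , _) n durfee i j 1≤j j≤i i≤n =
  below-durfee L durfee 1≤j (conj l i ∸ n) (ℕ.m∸n+n≡m n≤c) (part l (conj l i) ∸ i) j≤i i≤n
    (ℕ.m∸n+n≡m (≤-part-conj L (ℕ.≤-trans 1≤n n≤c)))
  where
  1≤n : 1 ≤ n
  1≤n = ℕ.≤-trans 1≤j (ℕ.≤-trans j≤i i≤n)
  n≤c : n ≤ conj l i
  n≤c = ≤-part⇒≤-conj L (ℕ.≤-trans 1≤j j≤i) (ℕ.≤-trans i≤n (proj₁ durfee))
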